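{- For every integer $n\ge4$, there exists a nontrivial cubic totally silver graph of order $4n$.
   Context: A totally silver coloring of a graph $G$ is a map $c$ from $V(G)$ to a set of colors such that for every $v\in V(G)$, each color appears exactly once on the closed neighborhood $N[v]$; a graph is totally silver if it admits one. Cubic means $3$--regular. A cubic totally silver graph is called nontrivial if it is $3$--connected and has girth at least $6$. -}

module Defs where

open import Data.Nat using (ℕ; zero; suc; _<_; _≤_)
open import Data.Fin using (Fin; toℕ)
open import Data.Bool using (Bool; true; false; if_then_else_)
open import Data.List using (List; map; allFin)
open import Data.Nat.ListAction using (sum)
open import Data.Empty using (⊥)
open import Data.Product using (Σ; ∃; _×_; _,_)
open import Data.Sum using (_⊎_)
open import Relation.Nullary using (¬_)
open import Relation.Binary.PropositionalEquality using (_≡_; _≢_)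
open import Function.Definitions using (Injective)

record Graph (m : ℕ) : Set where
  field
    adj   : Fin m → Fin m → Bool
    sym   : ∀ u v → adj u v ≡ adj v u
    irrefl : ∀ v → adj v v ≡ false
open Graph public

module _ {m : ℕ} (G : Graph m) where

  degree : Fin m → ℕ
  degree v = sum (map (λ u → if adj G v u then 1 else 0) (allFin m))

  Cubic : Set
  Cubic = ∀ v → degree v ≡ 3

  InClosedNbhd : Fin m → Fin m → Set
  InClosedNbhd v u = u ≡ v ⊎ adj G v u ≡ true

  IsTotallySilverColoring : {k : ℕ} → (Fin m → Fin k) → Set
  IsTotallySilverColoring {k} c =
    ∀ (v : Fin m) (col : Fin k) →
      (Σ (Fin m) λ u → InClosedNbhd v u × c u ≡ col)
      × (∀ u w → InClosedNbhd v u → InClosedNbhd v w →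
           c u ≡ col → c w ≡ col → u ≡ w)

  TotallySilver : Set
  TotallySilver = Σ ℕ λ k → Σ (Fin m → Fin k) λ c → IsTotallySilverColoring c

  data WalkAvoiding (X : Fin m → Set) : Fin m → Fin m → Set where
    here : ∀ {u} → ¬ X u → WalkAvoiding X u u
    step : ∀ {u v w} → ¬ X u → adj G u v ≡ true →
           WalkAvoiding X v w → WalkAvoiding X u w

  Connected : Set
  Connected = ∀ u w → WalkAvoiding (λ _ → ⊥) u w

  -- 3-connected: more than 3 vertices, and G − X is connected for every
  -- vertex set X with |X| < 3 (X = ∅, {x}, or {x,y}; {x} is the case x = y)
  ThreeConnected : Set
  ThreeConnected =
    3 < m × Connected ×
    (∀ x y u w → u ≢ x → u ≢ y → w ≢ x → w ≢ y →
       WalkAvoiding (λ z → z ≡ x ⊎ z ≡ y) u w)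

  HasCycleOfLength : ℕ → Set
  HasCycleOfLength ℓ =
    Σ (Fin ℓ → Fin m) λ f → Injective _≡_ _≡_ f ×
      (∀ i j → (suc (toℕ i) ≡ toℕ j ⊎ (suc (toℕ i) ≡ ℓ × toℕ j ≡ 0)) →
         adj G (f i) (f j) ≡ true)

  GirthAtLeast : ℕ → Set
  GirthAtLeast g = ∀ ℓ → 3 ≤ ℓ → ℓ < g → ¬ HasCycleOfLength ℓ

  NontrivialCubicTotallySilver : Set
  NontrivialCubicTotallySilver =
    Cubic × TotallySilver × ThreeConnected × GirthAtLeast 6

module Submission where

-- The graph is the 4-colour lift of K4 along Z_n.  Its vertices are pairs
-- (c , i) with colour c ∈ Fin 4 and block i ∈ Z_n; vertex (a , i) is joined
-- to (b , i + voltage a b) for each b ≠ a, where colour 0 (the hub) is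
-- joined with voltage 0 and the spokes 1 → 2 → 3 → 1 with voltage +1.
--
-- 1. Any "colour-neighbour system" (every vertex has exactly one neighbour
--    of each other colour, symmetrically) is a cubic graph on which the
--    colouring itself is totally silver (module ColourNeighbours).
-- 2. A cycle of length ℓ < 6 in the lift is a closed walk in K4 whose
--    colours never repeat within two steps; such walks have net voltage
--    ±1, ±2 or ±3 (exhaustive check), which is not 0 modulo n ≥ 4.
-- 3. After deleting two vertices, every vertex reaches the hub of a block
--    containing neither of them, and two such hubs are joined along one of
--    the three disjoint spoke strands (pigeonhole: each deleted vertex
--    blocks at most one strand).

open import Defs
open import Data.Nat using (ℕ; _≤_; _*_)
open import Data.Product using (Σ)

open import Data.Nat
  using (zero; suc; _+_; _∸_; _<_; ∣_-_∣; _≤?_; z≤n; s≤s; s≤s⁻¹; NonZero; >-nonZero; >-nonZero⁻¹)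
open import Data.Nat.Properties
  using (+-suc; +-assoc; +-comm; +-identityʳ; +-cancelˡ-≡; +-cancelʳ-<; +-mono-<; +-monoʳ-≤;
         *-monoʳ-≤; ≤-trans; ≤-<-trans; n≤1+n; <-irrefl; _<?_; ≮⇒≥; ≤-total; ∣-∣-comm;
         m≤n⇒∣m-n∣≡n∸m; m+[n∸m]≡n; m∸n+n≡m)
open import Data.Nat.DivMod
  using (_%_; m%n<n; %-distribˡ-+; m%n%n≡m%n; m<n⇒m%n≡m; m≤n⇒[n∸m]%m≡n%m; [m+n]%n≡m%n; [m+kn]%n≡m%n)
open import Data.Nat.GeneralisedArithmetic using (iterate)
open import Data.Nat.ListAction using (sum)
open import Data.Fin
  using (Fin; zero; suc; toℕ; fromℕ<; _≟_; punchIn; punchOut; combine; quotient; remainder)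
open import Data.Fin.Patterns using (0F; 1F; 2F; 3F; 4F)
open import Data.Fin.Properties
  using (suc-injective; toℕ-injective; toℕ<n; toℕ-fromℕ<; any?; all?; pigeonhole; <⇒≢;
         punchIn-injective; punchInᵢ≢i; punchIn-punchOut; remQuot-combine; combine-remQuot)
open import Data.Bool using (Bool; true; false; if_then_else_)
open import Data.List using (List; []; _∷_; tabulate)
open import Data.List.Properties using (map-tabulate)
open import Data.Empty using (⊥; ⊥-elim)
open import Data.Product using (_×_; _,_; proj₁; proj₂; ∃; ∃₂)
open import Data.Sum using (_⊎_; inj₁; inj₂; [_,_])
open import Function using (id; mk⇔)
open import Relation.Nullary using (¬_; Dec; yes; no; contradiction)
open import Relation.Nullary.Decidable
  using (⌊_⌋; does; ¬?; _×-dec_; _⊎-dec_; _→-dec_; from-yes; does-⇔; dec-true; dec-false)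
open import Relation.Binary.PropositionalEquality
  using (_≡_; _≢_; refl; cong; cong₂; subst; trans; module ≡-Reasoning) renaming (sym to ≡-sym)

count : ∀ {m} → (Fin m → Bool) → ℕ
count p = sum (tabulate (λ u → if p u then 1 else 0))

count-ext : ∀ {m} (p q : Fin m → Bool) → (∀ u → p u ≡ q u) → count p ≡ count q
count-ext {zero}  p q p≗q = refl
count-ext {suc m} p q p≗q rewrite p≗q zero =
  cong (_ +_) (count-ext (λ u → p (suc u)) (λ u → q (suc u)) (λ u → p≗q (suc u)))

count-none : ∀ {m} (p : Fin m → Bool) → (∀ u → p u ≡ false) → count p ≡ 0
count-none {zero}  p none = refl
count-none {suc m} p none rewrite none zero = count-none (λ u → p (suc u)) (λ u → none (suc u))

count-remove : ∀ {m} (p q : Fin m → Bool) a → p a ≡ true → q a ≡ false →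
  (∀ u → u ≢ a → p u ≡ q u) → count p ≡ suc (count q)
count-remove {suc m} p q zero pa qa p≗q rewrite pa | qa =
  cong suc (count-ext (λ u → p (suc u)) (λ u → q (suc u)) (λ u → p≗q (suc u) λ ()))
count-remove {suc m} p q (suc a) pa qa p≗q rewrite p≗q zero (λ ()) =
  trans (cong (_ +_) (count-remove (λ u → p (suc u)) (λ u → q (suc u)) a pa qa
                        (λ u u≢a → p≗q (suc u) (λ e → u≢a (suc-injective e)))))
        (+-suc _ _)

without : ∀ {m} → (Fin m → Bool) → Fin m → Fin m → Bool
without p a u = if ⌊ u ≟ a ⌋ then false else p u

without-at : ∀ {m} (p : Fin m → Bool) a → without p a a ≡ false
without-at p a with a ≟ a
... | yes _  = refl
... | no a≢a = ⊥-elim (a≢a refl)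

without-off : ∀ {m} (p : Fin m → Bool) {a} u → u ≢ a → without p a u ≡ p u
without-off p {a} u u≢a with u ≟ a
... | yes u≡a = ⊥-elim (u≢a u≡a)
... | no _    = refl

count-three : ∀ {m} (p : Fin m → Bool) a b c → a ≢ b → a ≢ c → b ≢ c →
  p a ≡ true → p b ≡ true → p c ≡ true →
  (∀ u → p u ≡ true → u ≡ a ⊎ u ≡ b ⊎ u ≡ c) → count p ≡ 3
count-three p a b c a≢b a≢c b≢c pa pb pc only = begin
  count p   ≡⟨ count-remove p p₁ a pa (without-at p a) (λ u u≢a → ≡-sym (without-off p u u≢a)) ⟩
  suc (count p₁) ≡⟨ cong suc (count-remove p₁ p₂ b p₁b (without-at p₁ b) (λ u u≢b → ≡-sym (without-off p₁ u u≢b))) ⟩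
  2 + count p₂   ≡⟨ cong (2 +_) (count-remove p₂ p₃ c p₂c (without-at p₂ c) (λ u u≢c → ≡-sym (without-off p₂ u u≢c))) ⟩
  3 + count p₃   ≡⟨ cong (3 +_) (count-none p₃ p₃-none) ⟩
  3              ∎
  where
  open ≡-Reasoning
  p₁ p₂ p₃ : Fin _ → Bool
  p₁ = without p a
  p₂ = without p₁ b
  p₃ = without p₂ c
  p₁b : p₁ b ≡ true
  p₁b = trans (without-off p b (λ e → a≢b (≡-sym e))) pb
  p₂c : p₂ c ≡ true
  p₂c = trans (without-off p₁ c (λ e → b≢c (≡-sym e)))
              (trans (without-off p c (λ e → a≢c (≡-sym e))) pc)
  p₃-none : ∀ u → p₃ u ≡ false
  p₃-none u with u ≟ c
  ... | yes _ = refl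
  ... | no u≢c with u ≟ b
  ... | yes _ = refl
  ... | no u≢b with u ≟ a
  ... | yes _ = refl
  ... | no u≢a with p u in pu
  ... | false = refl
  ... | true with only u pu
  ... | inj₁ u≡a        = ⊥-elim (u≢a u≡a)
  ... | inj₂ (inj₁ u≡b) = ⊥-elim (u≢b u≡b)
  ... | inj₂ (inj₂ u≡c) = ⊥-elim (u≢c u≡c)

module Walks {m} (G : Graph m) (X : Fin m → Set) where

  Walk : Fin m → Fin m → Set
  Walk = WalkAvoiding G X

  edge : ∀ {u w} → ¬ X u → ¬ X w → adj G u w ≡ true → Walk u w
  edge u∉X w∉X uw = step u∉X uw (here w∉X)

  infixr 5 _++_
  _++_ : ∀ {u v w} → Walk u v → Walk v w → Walk u w
  here _         ++ q = q
  step u∉X uv p ++ q = step u∉X uv (p ++ q)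

  end-avoids : ∀ {u w} → Walk u w → ¬ X w
  end-avoids (here w∉X)   = w∉X
  end-avoids (step _ _ p) = end-avoids p

  reverse : ∀ {u w} → Walk u w → Walk w u
  reverse (here u∉X)        = here u∉X
  reverse (step u∉X uv p) = reverse p ++ edge (end-avoids (reverse p)) u∉X (trans (Graph.sym G _ _) uv)

weaken : ∀ {m} (G : Graph m) {X Y : Fin m → Set} → (∀ z → Y z → X z) →
  ∀ {u w} → WalkAvoiding G X u w → WalkAvoiding G Y u w
weaken G Y⊆X (here u∉X)       = here (λ y → u∉X (Y⊆X _ y))
weaken G Y⊆X (step u∉X uv p) = step (λ y → u∉X (Y⊆X _ y)) uv (weaken G Y⊆X p)

decided-true : ∀ {A : Set} (a? : Dec A) → does a? ≡ true → A
decided-true (yes a) _ = a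

shared-blocker : ∀ {k m} (B : Fin k → Fin m → Set) → k < m → (∀ σ → ∃ λ β → B β σ) →
  ∃₂ λ σ τ → σ ≢ τ × ∃ λ β → B β σ × B β τ
shared-blocker B k<m blocked with pigeonhole k<m (λ σ → proj₁ (blocked σ))
... | σ , τ , σ<τ , same =
  σ , τ , <⇒≢ σ<τ , proj₁ (blocked σ) , proj₂ (blocked σ) ,
  subst (λ β → B β τ) (≡-sym same) (proj₂ (blocked τ))

unblocked : ∀ {k m} (B : Fin k → Fin m → Set) → (∀ β σ → Dec (B β σ)) →
  (∀ β {σ τ} → B β σ → B β τ → σ ≡ τ) → k < m → ∃ λ σ → ∀ β → ¬ B β σ
unblocked B B? at-most-one k<m with any? (λ σ → all? (λ β → ¬? (B? β σ)))
... | yes free = free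
... | no none = ⊥-elim (collide (shared-blocker B k<m blocked))
  where
  blocked : ∀ σ → ∃ λ β → B β σ
  blocked σ with any? (λ β → B? β σ)
  ... | yes found  = found
  ... | no nothing = ⊥-elim (none (σ , λ β b → nothing (β , b)))
  collide : (∃₂ λ σ τ → σ ≢ τ × ∃ λ β → B β σ × B β τ) → ⊥
  collide (σ , τ , σ≢τ , β , σ-blocked , τ-blocked) = σ≢τ (at-most-one β σ-blocked τ-blocked)

two-points : ∀ {A : Set} {p q j k l : A} → p ≡ j ⊎ q ≡ j → p ≡ k ⊎ q ≡ k → j ≢ k →
  l ≢ j → l ≢ k → ¬ (p ≡ l ⊎ q ≡ l)
two-points (inj₁ p≡j) (inj₁ p≡k) j≢k _ _ _ = j≢k (trans (≡-sym p≡j) p≡k)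
two-points (inj₂ q≡j) (inj₂ q≡k) j≢k _ _ _ = j≢k (trans (≡-sym q≡j) q≡k)
two-points (inj₁ p≡j) (inj₂ q≡k) _ l≢j l≢k (inj₁ p≡l) = l≢j (trans (≡-sym p≡l) p≡j)
two-points (inj₁ p≡j) (inj₂ q≡k) _ l≢j l≢k (inj₂ q≡l) = l≢k (trans (≡-sym q≡l) q≡k)
two-points (inj₂ q≡j) (inj₁ p≡k) _ l≢j l≢k (inj₁ p≡l) = l≢k (trans (≡-sym p≡l) p≡k)
two-points (inj₂ q≡j) (inj₁ p≡k) _ l≢j l≢k (inj₂ q≡l) = l≢j (trans (≡-sym q≡l) q≡j)

iterate-injective : ∀ {A : Set} (f : A → A) → (∀ {a b} → f a ≡ f b → a ≡ b) →
  ∀ t {a b} → iterate f a t ≡ iterate f b t → a ≡ b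
iterate-injective f f-inj zero    e = e
iterate-injective f f-inj (suc t) e = f-inj (iterate-injective f f-inj t e)

%-absorbˡ : ∀ a b n .{{_ : NonZero n}} → (a % n + b) % n ≡ (a + b) % n
%-absorbˡ a b n = begin
  (a % n + b) % n           ≡⟨ %-distribˡ-+ (a % n) b n ⟩
  (a % n % n + b % n) % n   ≡⟨ cong (λ t → (t + b % n) % n) (m%n%n≡m%n a n) ⟩
  (a % n + b % n) % n       ≡⟨ %-distribˡ-+ a b n ⟨
  (a + b) % n               ∎
  where open ≡-Reasoning

residue-shift : ∀ a d n .{{_ : NonZero n}} → 0 < d → d < n → (a + d) % n ≢ a % n
residue-shift a d n 0<d d<n eq = fixed-free (m%n<n a n) (trans (%-absorbˡ a d n) eq)
  where
  -- for r < n, r + d is either below n (and differs from r) or reduces to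
  -- r + d - n (and differs from r as d ≠ n)
  fixed-free : ∀ {r} → r < n → (r + d) % n ≢ r
  fixed-free {r} r<n r+d≡r with r + d <? n
  ... | yes r+d<n = <-irrefl (≡-sym d≡0) 0<d
    where
    d≡0 : d ≡ 0
    d≡0 = +-cancelˡ-≡ r d 0 (trans (trans (≡-sym (m<n⇒m%n≡m r+d<n)) r+d≡r) (≡-sym (+-identityʳ r)))
  ... | no r+d≮n = <-irrefl d≡n d<n
    where
    n≤r+d : n ≤ r + d
    n≤r+d = ≮⇒≥ r+d≮n
    t : ℕ
    t = r + d ∸ n
    t<n : t < n
    t<n = +-cancelʳ-< n t n (subst (_< n + n) (≡-sym (m∸n+n≡m n≤r+d)) (+-mono-< r<n d<n))
    t≡r : t ≡ r
    t≡r = trans (≡-sym (m<n⇒m%n≡m t<n)) (trans (m≤n⇒[n∸m]%m≡n%m n≤r+d) r+d≡r)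
    d≡n : d ≡ n
    d≡n = +-cancelˡ-≡ r d n (trans (≡-sym (m∸n+n≡m n≤r+d)) (cong (_+ n) t≡r))

%-cong-+ʳ : ∀ {a b} c n .{{_ : NonZero n}} → a % n ≡ b % n → (a + c) % n ≡ (b + c) % n
%-cong-+ʳ {a} {b} c n e = begin
  (a + c) % n       ≡⟨ %-absorbˡ a c n ⟨
  (a % n + c) % n   ≡⟨ cong (λ t → (t + c) % n) e ⟩
  (b % n + c) % n   ≡⟨ %-absorbˡ b c n ⟩
  (b + c) % n       ∎
  where open ≡-Reasoning

distinct-residues-≤ : ∀ a {p q} n .{{_ : NonZero n}} → p ≤ q → 0 < ∣ p - q ∣ → ∣ p - q ∣ < n →
  (a + p) % n ≢ (a + q) % n
distinct-residues-≤ a {p} {q} n p≤q 0<d d<n e =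
  residue-shift (a + p) (q ∸ p) n (subst (0 <_) d≡q∸p 0<d) (subst (_< n) d≡q∸p d<n)
    (trans (cong (_% n) (trans (+-assoc a p (q ∸ p)) (cong (a +_) (m+[n∸m]≡n p≤q)))) (≡-sym e))
  where
  d≡q∸p : ∣ p - q ∣ ≡ q ∸ p
  d≡q∸p = m≤n⇒∣m-n∣≡n∸m p≤q

distinct-residues : ∀ a p q n .{{_ : NonZero n}} → 0 < ∣ p - q ∣ → ∣ p - q ∣ < n →
  (a + p) % n ≢ (a + q) % n
distinct-residues a p q n 0<d d<n with ≤-total p q
... | inj₁ p≤q = distinct-residues-≤ a n p≤q 0<d d<n
... | inj₂ q≤p = λ e → distinct-residues-≤ a n q≤p (subst (0 <_) (∣-∣-comm p q) 0<d)
                         (subst (_< n) (∣-∣-comm p q) d<n) (≡-sym e)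

-- A vertex colouring with four colours together with a choice N x b of
-- "the neighbour of x of colour b", where x is its own neighbour of its
-- own colour and the choice is symmetric.
module ColourNeighbours {m} (colour : Fin m → Fin 4) (N : Fin m → Fin 4 → Fin m)
  (N-colour : ∀ x b → colour (N x b) ≡ b)
  (N-self   : ∀ x → N x (colour x) ≡ x)
  (N-inv    : ∀ x b → N (N x b) (colour x) ≡ x) where

  Adjacent : Fin m → Fin m → Set
  Adjacent x y = colour y ≢ colour x × y ≡ N x (colour y)

  adjacent? : ∀ x y → Dec (Adjacent x y)
  adjacent? x y = ¬? (colour y ≟ colour x) ×-dec (y ≟ N x (colour y))

  Adjacent-sym : ∀ {x y} → Adjacent x y → Adjacent y x
  Adjacent-sym {x} {y} (y≢x , y≡N) =
    (λ e → y≢x (≡-sym e)) , ≡-sym (trans (cong (λ z → N z (colour x)) y≡N) (N-inv x (colour y)))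

  graph : Graph m
  graph = record
    { adj    = λ x y → does (adjacent? x y)
    ; sym    = λ x y → does-⇔ (mk⇔ Adjacent-sym Adjacent-sym) (adjacent? x y) (adjacent? y x)
    ; irrefl = λ x → dec-false (adjacent? x x) (λ a → proj₁ a refl) }

  adjacent-elim : ∀ {x y} → adj graph x y ≡ true → Adjacent x y
  adjacent-elim {x} {y} = decided-true (adjacent? x y)

  adjacent-intro : ∀ {x y} → Adjacent x y → adj graph x y ≡ true
  adjacent-intro {x} {y} = dec-true (adjacent? x y)

  adjacent-N : ∀ x b → b ≢ colour x → adj graph x (N x b) ≡ true
  adjacent-N x b b≢cx = adjacent-intro
    ( (λ e → b≢cx (trans (≡-sym (N-colour x b)) e))
    , cong (N x) (≡-sym (N-colour x b)) )

  non-backtracking : ∀ {x y z} → adj graph x y ≡ true → adj graph y z ≡ true →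
    colour z ≡ colour x → z ≡ x
  non-backtracking {x} {y} {z} xy yz cz≡cx = begin
    z                      ≡⟨ proj₂ (adjacent-elim yz) ⟩
    N y (colour z)         ≡⟨ cong₂ N (proj₂ (adjacent-elim xy)) cz≡cx ⟩
    N (N x (colour y)) (colour x) ≡⟨ N-inv x (colour y) ⟩
    x                      ∎
    where open ≡-Reasoning

  adjacent-colours : ∀ {x y} → adj graph x y ≡ true → colour x ≢ colour y
  adjacent-colours xy e = proj₁ (adjacent-elim xy) (≡-sym e)

  gap-colours : ∀ {x y z} → adj graph x y ≡ true → adj graph y z ≡ true → x ≢ z →
    colour x ≢ colour z
  gap-colours xy yz x≢z e = x≢z (≡-sym (non-backtracking xy yz (≡-sym e)))

  closed-nbhd-elim : ∀ {x u} → InClosedNbhd graph x u → u ≡ N x (colour u)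
  closed-nbhd-elim {x} (inj₁ refl) = ≡-sym (N-self x)
  closed-nbhd-elim (inj₂ xu)       = proj₂ (adjacent-elim xu)

  closed-nbhd-N : ∀ x b → InClosedNbhd graph x (N x b)
  closed-nbhd-N x b with b ≟ colour x
  ... | yes refl  = inj₁ (N-self x)
  ... | no b≢cx   = inj₂ (adjacent-N x b b≢cx)

  -- The colouring itself is totally silver: N x b is the only vertex of
  -- colour b in the closed neighbourhood of x.
  silver : TotallySilver graph
  silver = 4 , colour , λ x b →
    (N x b , closed-nbhd-N x b , N-colour x b) ,
    λ u w xu xw cu≡b cw≡b →
      trans (closed-nbhd-elim xu) (trans (cong (N x) (trans cu≡b (≡-sym cw≡b))) (≡-sym (closed-nbhd-elim xw)))

  -- The neighbours of x are N x (punchIn (colour x) j) for the three j : Fin 3.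
  cubic : Cubic graph
  cubic x = trans (cong sum (map-tabulate id (λ u → if adj graph x u then 1 else 0)))
    (count-three (adj graph x) (nb 0F) (nb 1F) (nb 2F)
      (nb-injective (λ ())) (nb-injective (λ ())) (nb-injective (λ ()))
      (nb-adjacent 0F) (nb-adjacent 1F) (nb-adjacent 2F) only)
    where
    a : Fin 4
    a = colour x
    nb : Fin 3 → Fin m
    nb j = N x (punchIn a j)
    nb-adjacent : ∀ j → adj graph x (nb j) ≡ true
    nb-adjacent j = adjacent-N x (punchIn a j) (punchInᵢ≢i a j)
    nb-injective : ∀ {j k} → j ≢ k → nb j ≢ nb k
    nb-injective {j} {k} j≢k e =
      j≢k (punchIn-injective a j k (trans (≡-sym (N-colour x _)) (trans (cong colour e) (N-colour x _))))
    only : ∀ u → adj graph x u ≡ true → u ≡ nb 0F ⊎ u ≡ nb 1F ⊎ u ≡ nb 2F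
    only u xu = which (punchOut a≢cu) (trans u≡N (cong (N x) (≡-sym (punchIn-punchOut a≢cu))))
      where
      a≢cu : a ≢ colour u
      a≢cu e = proj₁ (adjacent-elim xu) (≡-sym e)
      u≡N : u ≡ N x (colour u)
      u≡N = proj₂ (adjacent-elim xu)
      which : ∀ j → u ≡ nb j → u ≡ nb 0F ⊎ u ≡ nb 1F ⊎ u ≡ nb 2F
      which 0F e = inj₁ e
      which 1F e = inj₂ (inj₁ e)
      which 2F e = inj₂ (inj₂ e)

-- Colour 0 is the hub, colours suc s (s : Fin 3) are the spokes.
data Voltage : Set where
  stay fwd bwd : Voltage

invert : Voltage → Voltage
invert stay = stay
invert fwd  = bwd
invert bwd  = fwd

rot rot⁻ : Fin 3 → Fin 3
rot 0F = 1F
rot 1F = 2F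
rot 2F = 0F
rot⁻ 0F = 2F
rot⁻ 1F = 0F
rot⁻ 2F = 1F

rot⁻-rot : ∀ s → rot⁻ (rot s) ≡ s
rot⁻-rot 0F = refl
rot⁻-rot 1F = refl
rot⁻-rot 2F = refl

rot-injective : ∀ {s t} → rot s ≡ rot t → s ≡ t
rot-injective {s} {t} e = trans (≡-sym (rot⁻-rot s)) (trans (cong rot⁻ e) (rot⁻-rot t))

rot-moves : ∀ s → Fin.suc {3} (rot s) ≢ suc s
rot-moves 0F ()
rot-moves 1F ()
rot-moves 2F ()

rot⁻-moves : ∀ s → Fin.suc {3} (rot⁻ s) ≢ suc s
rot⁻-moves 0F ()
rot⁻-moves 1F ()
rot⁻-moves 2F ()

voltage : Fin 4 → Fin 4 → Voltage
voltage 1F 2F = fwd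
voltage 2F 3F = fwd
voltage 3F 1F = fwd
voltage 2F 1F = bwd
voltage 3F 2F = bwd
voltage 1F 3F = bwd
voltage _  _  = stay

voltage-diag : ∀ a → voltage a a ≡ stay
voltage-diag 0F = refl
voltage-diag 1F = refl
voltage-diag 2F = refl
voltage-diag 3F = refl

voltage-anti : ∀ a b → voltage b a ≡ invert (voltage a b)
voltage-anti 0F 0F = refl
voltage-anti 0F 1F = refl
voltage-anti 0F 2F = refl
voltage-anti 0F 3F = refl
voltage-anti 1F 0F = refl
voltage-anti 1F 1F = refl
voltage-anti 1F 2F = refl
voltage-anti 1F 3F = refl
voltage-anti 2F 0F = refl
voltage-anti 2F 1F = refl
voltage-anti 2F 2F = refl
voltage-anti 2F 3F = refl
voltage-anti 3F 0F = refl
voltage-anti 3F 1F = refl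
voltage-anti 3F 2F = refl
voltage-anti 3F 3F = refl

voltage-hub-spoke : ∀ s → voltage 0F (suc s) ≡ stay
voltage-hub-spoke 0F = refl
voltage-hub-spoke 1F = refl
voltage-hub-spoke 2F = refl

voltage-spoke-hub : ∀ s → voltage (suc s) 0F ≡ stay
voltage-spoke-hub 0F = refl
voltage-spoke-hub 1F = refl
voltage-spoke-hub 2F = refl

voltage-rot : ∀ s → voltage (suc s) (suc (rot s)) ≡ fwd
voltage-rot 0F = refl
voltage-rot 1F = refl
voltage-rot 2F = refl

voltage-rot⁻ : ∀ s → voltage (suc s) (suc (rot⁻ s)) ≡ bwd
voltage-rot⁻ 0F = refl
voltage-rot⁻ 1F = refl
voltage-rot⁻ 2F = refl

-- Numbers of forward and backward arcs in a list of voltages, and their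
-- difference: the net voltage of a closed walk is ± its imbalance.
forwards backwards : List Voltage → ℕ
forwards []          = 0
forwards (fwd ∷ vs)  = suc (forwards vs)
forwards (_   ∷ vs)  = forwards vs
backwards []         = 0
backwards (bwd ∷ vs) = suc (backwards vs)
backwards (_   ∷ vs) = backwards vs

imbalance : List Voltage → ℕ
imbalance vs = ∣ forwards vs - backwards vs ∣

Unbalanced : List Voltage → Set
Unbalanced vs = 0 < imbalance vs × imbalance vs ≤ 3

unbalanced? : ∀ vs → Dec (Unbalanced vs)
unbalanced? vs = (0 <? imbalance vs) ×-dec (imbalance vs ≤? 3)

-- Every closed walk in K4 of length 3, 4 or 5 that never returns to the
-- colour it had two steps before is unbalanced (length 5 is impossible,
-- as it would need five distinct colours).
triangle-unbalanced : ∀ a b c → a ≢ b → b ≢ c → c ≢ a →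
  Unbalanced (voltage a b ∷ voltage b c ∷ voltage c a ∷ [])
triangle-unbalanced = from-yes (all? λ a → all? λ b → all? λ c →
  ¬? (a ≟ b) →-dec ¬? (b ≟ c) →-dec ¬? (c ≟ a) →-dec
  unbalanced? (voltage a b ∷ voltage b c ∷ voltage c a ∷ []))

square-unbalanced : ∀ a b c d → a ≢ b → b ≢ c → c ≢ d → d ≢ a → a ≢ c → b ≢ d →
  Unbalanced (voltage a b ∷ voltage b c ∷ voltage c d ∷ voltage d a ∷ [])
square-unbalanced = from-yes (all? λ a → all? λ b → all? λ c → all? λ d →
  ¬? (a ≟ b) →-dec ¬? (b ≟ c) →-dec ¬? (c ≟ d) →-dec ¬? (d ≟ a) →-dec
  ¬? (a ≟ c) →-dec ¬? (b ≟ d) →-dec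
  unbalanced? (voltage a b ∷ voltage b c ∷ voltage c d ∷ voltage d a ∷ []))

pentagon-unbalanced : ∀ a b c d e → a ≢ b → b ≢ c → c ≢ d → d ≢ e → e ≢ a →
  a ≢ c → b ≢ d → c ≢ e → d ≢ a → e ≢ b →
  Unbalanced (voltage a b ∷ voltage b c ∷ voltage c d ∷ voltage d e ∷ voltage e a ∷ [])
pentagon-unbalanced = from-yes (all? λ a → all? λ b → all? λ c → all? λ d → all? λ e →
  ¬? (a ≟ b) →-dec ¬? (b ≟ c) →-dec ¬? (c ≟ d) →-dec ¬? (d ≟ e) →-dec ¬? (e ≟ a) →-dec
  ¬? (a ≟ c) →-dec ¬? (b ≟ d) →-dec ¬? (c ≟ e) →-dec ¬? (d ≟ a) →-dec ¬? (e ≟ b) →-dec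
  unbalanced? (voltage a b ∷ voltage b c ∷ voltage c d ∷ voltage d e ∷ voltage e a ∷ []))

-- Vertex (c , i) of Fin 4 × Fin n is encoded as combine c i : Fin (4 * n);
-- the neighbour of (a , i) of colour b is (b , i + voltage a b) mod n.
module Lift (n : ℕ) .{{_ : NonZero n}} where

  opaque
    vertex : Fin 4 → Fin n → Fin (4 * n)
    vertex = combine

    colour : Fin (4 * n) → Fin 4
    colour = quotient n

    block : Fin (4 * n) → Fin n
    block = remainder {4} n

    colour-vertex : ∀ c i → colour (vertex c i) ≡ c
    colour-vertex c i = cong proj₁ (remQuot-combine c i)

    block-vertex : ∀ c i → block (vertex c i) ≡ i
    block-vertex c i = cong proj₂ (remQuot-combine c i)

    vertex-η : ∀ x → vertex (colour x) (block x) ≡ x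
    vertex-η = combine-remQuot {4} n

  offset : Voltage → ℕ
  offset stay = 0
  offset fwd  = 1
  offset bwd  = n ∸ 1

  opaque
    shift : Voltage → Fin n → Fin n
    shift v i = fromℕ< (m%n<n (toℕ i + offset v) n)

    toℕ-shift : ∀ v i → toℕ (shift v i) ≡ (toℕ i + offset v) % n
    toℕ-shift v i = toℕ-fromℕ< _

  offset-invert : ∀ a v → (a + offset v + offset (invert v)) % n ≡ a % n
  offset-invert a stay = cong (_% n) (trans (+-identityʳ (a + 0)) (+-identityʳ a))
  offset-invert a fwd  = trans (cong (_% n) (trans (+-assoc a 1 (n ∸ 1)) (cong (a +_) (m+[n∸m]≡n (>-nonZero⁻¹ n)))))
                               ([m+n]%n≡m%n a n)
  offset-invert a bwd  = trans (cong (_% n) (trans (+-assoc a (n ∸ 1) 1) (cong (a +_) (m∸n+n≡m (>-nonZero⁻¹ n)))))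
                               ([m+n]%n≡m%n a n)

  shift-inverse : ∀ v i → shift (invert v) (shift v i) ≡ i
  shift-inverse v i = toℕ-injective (begin
    toℕ (shift (invert v) (shift v i))                 ≡⟨ toℕ-shift (invert v) (shift v i) ⟩
    (toℕ (shift v i) + offset (invert v)) % n           ≡⟨ cong (λ t → (t + offset (invert v)) % n) (toℕ-shift v i) ⟩
    ((toℕ i + offset v) % n + offset (invert v)) % n    ≡⟨ %-absorbˡ (toℕ i + offset v) (offset (invert v)) n ⟩
    (toℕ i + offset v + offset (invert v)) % n          ≡⟨ offset-invert (toℕ i) v ⟩
    toℕ i % n                                           ≡⟨ m<n⇒m%n≡m (toℕ<n i) ⟩
    toℕ i                                               ∎)
    where open ≡-Reasoning

  shift-stay : ∀ i → shift stay i ≡ i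
  shift-stay i = toℕ-injective (trans (toℕ-shift stay i)
    (trans (cong (_% n) (+-identityʳ (toℕ i))) (m<n⇒m%n≡m (toℕ<n i))))

  N : Fin (4 * n) → Fin 4 → Fin (4 * n)
  N x b = vertex b (shift (voltage (colour x) b) (block x))

  N-colour : ∀ x b → colour (N x b) ≡ b
  N-colour x b = colour-vertex b _

  N-self : ∀ x → N x (colour x) ≡ x
  N-self x = trans (cong (vertex (colour x))
                     (trans (cong (λ v → shift v (block x)) (voltage-diag (colour x))) (shift-stay (block x))))
                   (vertex-η x)

  N-inv : ∀ x b → N (N x b) (colour x) ≡ x
  N-inv x b = begin
    N (N x b) (colour x)
      ≡⟨ cong₂ (λ c i → vertex (colour x) (shift (voltage c (colour x)) i)) (N-colour x b) (block-vertex b _) ⟩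
    vertex (colour x) (shift (voltage b (colour x)) (shift (voltage (colour x) b) (block x)))
      ≡⟨ cong (λ v → vertex (colour x) (shift v (shift (voltage (colour x) b) (block x)))) (voltage-anti (colour x) b) ⟩
    vertex (colour x) (shift (invert (voltage (colour x) b)) (shift (voltage (colour x) b) (block x)))
      ≡⟨ cong (vertex (colour x)) (shift-inverse (voltage (colour x) b) (block x)) ⟩
    vertex (colour x) (block x)
      ≡⟨ vertex-η x ⟩
    x ∎
    where open ≡-Reasoning

  open ColourNeighbours colour N N-colour N-self N-inv public

  block-step : ∀ {x y} → adj graph x y ≡ true →
    toℕ (block y) ≡ (toℕ (block x) + offset (voltage (colour x) (colour y))) % n
  block-step {x} {y} xy = begin
    toℕ (block y)                                 ≡⟨ cong (λ z → toℕ (block z)) (proj₂ (adjacent-elim xy)) ⟩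
    toℕ (block (N x (colour y)))                  ≡⟨ cong toℕ (block-vertex (colour y) _) ⟩
    toℕ (shift (voltage (colour x) (colour y)) (block x)) ≡⟨ toℕ-shift (voltage (colour x) (colour y)) (block x) ⟩
    (toℕ (block x) + offset (voltage (colour x) (colour y))) % n ∎
    where open ≡-Reasoning

  data Trail : Fin (4 * n) → Fin (4 * n) → List Voltage → Set where
    []  : ∀ {x} → Trail x x []
    _∷_ : ∀ {x y z vs} → adj graph x y ≡ true → Trail y z vs →
          Trail x z (voltage (colour x) (colour y) ∷ vs)

  total : List Voltage → ℕ
  total []       = 0
  total (v ∷ vs) = offset v + total vs

  trail-block : ∀ {x z vs} → Trail x z vs → toℕ (block z) ≡ (toℕ (block x) + total vs) % n
  trail-block {x} [] = trans (≡-sym (m<n⇒m%n≡m (toℕ<n (block x)))) (cong (_% n) (≡-sym (+-identityʳ _)))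
  trail-block {x} {z} (_∷_ {y = y} {vs = vs} xy t) = begin
    toℕ (block z)                             ≡⟨ trail-block t ⟩
    (toℕ (block y) + total vs) % n            ≡⟨ cong (λ b → (b + total vs) % n) (block-step xy) ⟩
    ((toℕ (block x) + o) % n + total vs) % n  ≡⟨ %-absorbˡ (toℕ (block x) + o) (total vs) n ⟩
    (toℕ (block x) + o + total vs) % n        ≡⟨ cong (_% n) (+-assoc (toℕ (block x)) o (total vs)) ⟩
    (toℕ (block x) + (o + total vs)) % n      ∎
    where
    open ≡-Reasoning
    o : ℕ
    o = offset (voltage (colour x) (colour y))

  -- A backward arc is worth n - 1 forward steps.
  total-split : ∀ vs → total vs + backwards vs ≡ forwards vs + backwards vs * n
  total-split []          = refl
  total-split (stay ∷ vs) = total-split vs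
  total-split (fwd ∷ vs)  = cong suc (total-split vs)
  total-split (bwd ∷ vs)  = begin
    n ∸ 1 + T + suc B        ≡⟨ +-assoc (n ∸ 1) T (suc B) ⟩
    n ∸ 1 + (T + suc B)      ≡⟨ cong (n ∸ 1 +_) (+-suc T B) ⟩
    n ∸ 1 + suc (T + B)      ≡⟨ +-suc (n ∸ 1) (T + B) ⟩
    suc (n ∸ 1) + (T + B)    ≡⟨ cong (_+ (T + B)) (m+[n∸m]≡n (>-nonZero⁻¹ n)) ⟩
    n + (T + B)              ≡⟨ cong (n +_) (total-split vs) ⟩
    n + (F + B * n)          ≡⟨ +-assoc n F (B * n) ⟨
    n + F + B * n            ≡⟨ cong (_+ B * n) (+-comm n F) ⟩
    F + n + B * n            ≡⟨ +-assoc F n (B * n) ⟩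
    F + (n + B * n)          ∎
    where
    open ≡-Reasoning
    T B F : ℕ
    T = total vs
    B = backwards vs
    F = forwards vs

  closed-trail-balance : ∀ {x vs} → Trail x x vs →
    (toℕ (block x) + backwards vs) % n ≡ (toℕ (block x) + forwards vs) % n
  closed-trail-balance {x} {vs} t = begin
    (a + B) % n             ≡⟨ %-cong-+ʳ B n (trans (m<n⇒m%n≡m (toℕ<n (block x))) (trail-block t)) ⟩
    (a + total vs + B) % n  ≡⟨ cong (_% n) (+-assoc a (total vs) B) ⟩
    (a + (total vs + B)) % n ≡⟨ cong (λ t → (a + t) % n) (total-split vs) ⟩
    (a + (F + B * n)) % n   ≡⟨ cong (_% n) (+-assoc a F (B * n)) ⟨
    (a + F + B * n) % n     ≡⟨ [m+kn]%n≡m%n (a + F) B n ⟩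
    (a + F) % n             ∎
    where
    open ≡-Reasoning
    a B F : ℕ
    a = toℕ (block x)
    B = backwards vs
    F = forwards vs

  no-unbalanced-closed-trail : 3 < n → ∀ {x vs} → Trail x x vs → ¬ Unbalanced vs
  no-unbalanced-closed-trail 3<n {x} t (0<d , d≤3) =
    distinct-residues (toℕ (block x)) _ _ n 0<d (≤-<-trans d≤3 3<n) (≡-sym (closed-trail-balance t))

  -- A cycle of length 3, 4 or 5 is a closed walk whose colours never
  -- repeat within two steps; such walks are unbalanced, so for n ≥ 4
  -- there are no such cycles.
  no-triangle : 3 < n → ¬ HasCycleOfLength graph 3
  no-triangle 3<n (f , f-inj , f-adj) =
    no-unbalanced-closed-trail 3<n (a01 ∷ a12 ∷ a20 ∷ [])
      (triangle-unbalanced _ _ _ (adjacent-colours a01) (adjacent-colours a12) (adjacent-colours a20))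
    where
    a01 : adj graph (f 0F) (f 1F) ≡ true
    a01 = f-adj 0F 1F (inj₁ refl)
    a12 : adj graph (f 1F) (f 2F) ≡ true
    a12 = f-adj 1F 2F (inj₁ refl)
    a20 : adj graph (f 2F) (f 0F) ≡ true
    a20 = f-adj 2F 0F (inj₂ (refl , refl))
  no-square : 3 < n → ¬ HasCycleOfLength graph 4
  no-square 3<n (f , f-inj , f-adj) =
    no-unbalanced-closed-trail 3<n (a01 ∷ a12 ∷ a23 ∷ a30 ∷ [])
      (square-unbalanced _ _ _ _
        (adjacent-colours a01) (adjacent-colours a12) (adjacent-colours a23) (adjacent-colours a30)
        (gap-colours a01 a12 (λ e → contradiction (f-inj e) λ ()))
        (gap-colours a12 a23 (λ e → contradiction (f-inj e) λ ())))
    where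
    a01 : adj graph (f 0F) (f 1F) ≡ true
    a01 = f-adj 0F 1F (inj₁ refl)
    a12 : adj graph (f 1F) (f 2F) ≡ true
    a12 = f-adj 1F 2F (inj₁ refl)
    a23 : adj graph (f 2F) (f 3F) ≡ true
    a23 = f-adj 2F 3F (inj₁ refl)
    a30 : adj graph (f 3F) (f 0F) ≡ true
    a30 = f-adj 3F 0F (inj₂ (refl , refl))
  no-pentagon : 3 < n → ¬ HasCycleOfLength graph 5
  no-pentagon 3<n (f , f-inj , f-adj) =
    no-unbalanced-closed-trail 3<n (a01 ∷ a12 ∷ a23 ∷ a34 ∷ a40 ∷ [])
      (pentagon-unbalanced _ _ _ _ _
        (adjacent-colours a01) (adjacent-colours a12) (adjacent-colours a23)
        (adjacent-colours a34) (adjacent-colours a40)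
        (gap-colours a01 a12 (λ e → contradiction (f-inj e) λ ()))
        (gap-colours a12 a23 (λ e → contradiction (f-inj e) λ ()))
        (gap-colours a23 a34 (λ e → contradiction (f-inj e) λ ()))
        (gap-colours a34 a40 (λ e → contradiction (f-inj e) λ ()))
        (gap-colours a40 a01 (λ e → contradiction (f-inj e) λ ())))
    where
    a01 : adj graph (f 0F) (f 1F) ≡ true
    a01 = f-adj 0F 1F (inj₁ refl)
    a12 : adj graph (f 1F) (f 2F) ≡ true
    a12 = f-adj 1F 2F (inj₁ refl)
    a23 : adj graph (f 2F) (f 3F) ≡ true
    a23 = f-adj 2F 3F (inj₁ refl)
    a34 : adj graph (f 3F) (f 4F) ≡ true
    a34 = f-adj 3F 4F (inj₁ refl)
    a40 : adj graph (f 4F) (f 0F) ≡ true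
    a40 = f-adj 4F 0F (inj₂ (refl , refl))

  girth : 3 < n → GirthAtLeast graph 6
  girth 3<n 0 () _
  girth 3<n 1 (s≤s ()) _
  girth 3<n 2 (s≤s (s≤s ())) _
  girth 3<n 3 _ _ = no-triangle 3<n
  girth 3<n 4 _ _ = no-square 3<n
  girth 3<n 5 _ _ = no-pentagon 3<n
  girth 3<n (suc (suc (suc (suc (suc (suc _)))))) _ (s≤s (s≤s (s≤s (s≤s (s≤s (s≤s ())))))) _

  -- Layout: the hub of block i is (0 , i), its spokes are (suc s , i).
  -- Hubs are joined to the spokes of their block, and spoke s of block i
  -- to spoke rot s of block i + 1.
  hub : Fin n → Fin (4 * n)
  hub = vertex 0F

  spoke : Fin 3 → Fin n → Fin (4 * n)
  spoke s = vertex (suc s)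

  next prev : Fin n → Fin n
  next = shift fwd
  prev = shift bwd

  vertex-injective : ∀ {c c' i i'} → vertex c i ≡ vertex c' i' → c ≡ c' × i ≡ i'
  vertex-injective {c} {c'} {i} {i'} e =
    trans (≡-sym (colour-vertex c i)) (trans (cong colour e) (colour-vertex c' i')) ,
    trans (≡-sym (block-vertex c i)) (trans (cong block e) (block-vertex c' i'))

  arc : ∀ a b i j → b ≢ a → shift (voltage a b) i ≡ j → adj graph (vertex a i) (vertex b j) ≡ true
  arc a b i j b≢a shifted = subst (λ z → adj graph (vertex a i) z ≡ true) N≡
    (adjacent-N (vertex a i) b (λ e → b≢a (trans e (colour-vertex a i))))
    where
    N≡ : N (vertex a i) b ≡ vertex b j
    N≡ = cong (vertex b) (trans (cong₂ (λ c k → shift (voltage c b) k) (colour-vertex a i) (block-vertex a i)) shifted)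

  hub-spoke : ∀ s i → adj graph (hub i) (spoke s i) ≡ true
  hub-spoke s i = arc 0F (suc s) i i (λ ()) (trans (cong (λ v → shift v i) (voltage-hub-spoke s)) (shift-stay i))

  spoke-hub : ∀ s i → adj graph (spoke s i) (hub i) ≡ true
  spoke-hub s i = arc (suc s) 0F i i (λ ()) (trans (cong (λ v → shift v i) (voltage-spoke-hub s)) (shift-stay i))

  spoke-next : ∀ s i → adj graph (spoke s i) (spoke (rot s) (next i)) ≡ true
  spoke-next s i = arc (suc s) (suc (rot s)) i (next i) (rot-moves s) (cong (λ v → shift v i) (voltage-rot s))

  spoke-prev : ∀ s i → adj graph (spoke s i) (spoke (rot⁻ s) (prev i)) ≡ true
  spoke-prev s i = arc (suc s) (suc (rot⁻ s)) i (prev i) (rot⁻-moves s) (cong (λ v → shift v i) (voltage-rot⁻ s))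

  toℕ-iterate-next : ∀ t i → toℕ (iterate next i t) ≡ (toℕ i + t) % n
  toℕ-iterate-next zero i = trans (≡-sym (m<n⇒m%n≡m (toℕ<n i))) (cong (_% n) (≡-sym (+-identityʳ _)))
  toℕ-iterate-next (suc t) i = begin
    toℕ (iterate next (next i) t)  ≡⟨ toℕ-iterate-next t (next i) ⟩
    (toℕ (next i) + t) % n         ≡⟨ cong (λ k → (k + t) % n) (toℕ-shift fwd i) ⟩
    ((toℕ i + 1) % n + t) % n      ≡⟨ %-absorbˡ (toℕ i + 1) t n ⟩
    (toℕ i + 1 + t) % n            ≡⟨ cong (_% n) (+-assoc (toℕ i) 1 t) ⟩
    (toℕ i + suc t) % n            ∎
    where open ≡-Reasoning

  toℕ-iterate-next-< : ∀ t i → toℕ i + t < n → toℕ (iterate next i t) ≡ toℕ i + t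
  toℕ-iterate-next-< t i i+t<n = trans (toℕ-iterate-next t i) (m<n⇒m%n≡m i+t<n)

  iterate-next-moves : ∀ t i → 0 < t → t < n → iterate next i t ≢ i
  iterate-next-moves t i 0<t t<n e = residue-shift (toℕ i) t n 0<t t<n
    (trans (≡-sym (toℕ-iterate-next t i)) (trans (cong toℕ e) (≡-sym (m<n⇒m%n≡m (toℕ<n i)))))

  next-prev : ∀ i → next (prev i) ≡ i
  next-prev = shift-inverse bwd

  next-moves : 2 < n → ∀ i → next i ≢ i
  next-moves 2<n i = iterate-next-moves 1 i (s≤s z≤n) (≤-<-trans (s≤s z≤n) 2<n)

  prev-moves : 2 < n → ∀ i → prev i ≢ i
  prev-moves 2<n i e = next-moves 2<n i (trans (cong next (≡-sym e)) (next-prev i))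

  prev≢next : 2 < n → ∀ i → prev i ≢ next i
  prev≢next 2<n i e = iterate-next-moves 2 i (s≤s z≤n) 2<n (trans (cong next (≡-sym e)) (next-prev i))

  spoke-avoiding : ∀ i p q → ∃ λ s → spoke s i ≢ p × spoke s i ≢ q
  spoke-avoiding i p q =
    let (s , free) = unblocked hits (λ { 0F s → spoke s i ≟ p ; 1F s → spoke s i ≟ q })
                       (λ { 0F → same-spoke ; 1F → same-spoke }) (s≤s (s≤s (s≤s z≤n)))
    in s , free 0F , free 1F
    where
    hits : Fin 2 → Fin 3 → Set
    hits 0F s = spoke s i ≡ p
    hits 1F s = spoke s i ≡ q
    same-spoke : ∀ {z s t} → spoke s i ≡ z → spoke t i ≡ z → s ≡ t
    same-spoke s≡z t≡z = suc-injective (proj₁ (vertex-injective (trans s≡z (≡-sym t≡z))))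

  -- A block is clean if it contains neither x nor y.  Every remaining
  -- vertex reaches the hub of a clean block, and the hubs of any two
  -- clean blocks are joined through one of the three spoke strands.
  module Separation (2<n : 2 < n) (x y : Fin (4 * n)) where

    Removed : Fin (4 * n) → Set
    Removed z = z ≡ x ⊎ z ≡ y

    open Walks graph Removed

    Dirty : Fin n → Set
    Dirty j = block x ≡ j ⊎ block y ≡ j

    dirty? : ∀ j → Dec (Dirty j)
    dirty? j = (block x ≟ j) ⊎-dec (block y ≟ j)

    clean-kept : ∀ {j} → ¬ Dirty j → ∀ c → ¬ Removed (vertex c j)
    clean-kept {j} clean c (inj₁ e) = clean (inj₁ (trans (cong block (≡-sym e)) (block-vertex c j)))
    clean-kept {j} clean c (inj₂ e) = clean (inj₂ (trans (cong block (≡-sym e)) (block-vertex c j)))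

    strand-vertex : ℕ → Fin 3 → Fin n → Fin (4 * n)
    strand-vertex t σ a = spoke (iterate rot σ t) (iterate next a t)

    strand : ∀ d σ a → (∀ (t : Fin (suc d)) → ¬ Removed (strand-vertex (toℕ t) σ a)) →
      Walk (spoke σ a) (strand-vertex d σ a)
    strand zero    σ a kept = here (kept zero)
    strand (suc d) σ a kept =
      edge (kept zero) (kept (suc zero)) (spoke-next σ a) ++ strand d (rot σ) (next a) (λ t → kept (suc t))

    OnStrand : ℕ → Fin n → Fin (4 * n) → Fin 3 → Set
    OnStrand d a z σ = ∃ λ (t : Fin (suc d)) → strand-vertex (toℕ t) σ a ≡ z

    on-strand? : ∀ d a z σ → Dec (OnStrand d a z σ)
    on-strand? d a z σ = any? (λ t → strand-vertex (toℕ t) σ a ≟ z)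

    strands-disjoint : ∀ {d a z σ τ} → toℕ a + d < n → OnStrand d a z σ → OnStrand d a z τ → σ ≡ τ
    strands-disjoint {d} {a} {z} {σ} {τ} a+d<n (t , σ-at-t) (u , τ-at-u) =
      iterate-injective rot rot-injective (toℕ t) (trans colours (cong (iterate rot τ) (≡-sym t≡u)))
      where
      same : suc (iterate rot σ (toℕ t)) ≡ suc (iterate rot τ (toℕ u)) ×
             iterate next a (toℕ t) ≡ iterate next a (toℕ u)
      same = vertex-injective (trans σ-at-t (≡-sym τ-at-u))
      colours : iterate rot σ (toℕ t) ≡ iterate rot τ (toℕ u)
      colours = suc-injective (proj₁ same)
      fits : ∀ (t : Fin (suc d)) → toℕ a + toℕ t < n
      fits t = ≤-<-trans (+-monoʳ-≤ (toℕ a) (s≤s⁻¹ (toℕ<n t))) a+d<n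
      t≡u : toℕ t ≡ toℕ u
      t≡u = +-cancelˡ-≡ (toℕ a) (toℕ t) (toℕ u)
              (trans (≡-sym (toℕ-iterate-next-< (toℕ t) a (fits t)))
                     (trans (cong toℕ (proj₂ same)) (toℕ-iterate-next-< (toℕ u) a (fits u))))

    -- x and y each lie on at most one of the three strands, so the third
    -- one joins the hubs of two clean blocks.
    hubs-joined-≤ : ∀ a b d → toℕ b ≡ toℕ a + d → ¬ Dirty a → ¬ Dirty b → Walk (hub a) (hub b)
    hubs-joined-≤ a b d b≡a+d a-clean b-clean =
      subst (λ j → Walk (hub a) (hub j)) arrives
        (edge (clean-kept a-clean 0F) (kept zero) (hub-spoke σ a) ++ along ++
         edge (end-avoids along) (clean-kept end-clean 0F) (spoke-hub (iterate rot σ d) _))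
      where
      a+d<n : toℕ a + d < n
      a+d<n = subst (_< n) b≡a+d (toℕ<n b)
      blocked-by : Fin 2 → Fin 3 → Set
      blocked-by 0F = OnStrand d a x
      blocked-by 1F = OnStrand d a y
      free : ∃ λ σ → ∀ β → ¬ blocked-by β σ
      free = unblocked blocked-by
               (λ { 0F → on-strand? d a x ; 1F → on-strand? d a y })
               (λ { 0F → strands-disjoint a+d<n ; 1F → strands-disjoint a+d<n })
               (s≤s (s≤s (s≤s z≤n)))
      σ : Fin 3
      σ = proj₁ free
      kept : ∀ (t : Fin (suc d)) → ¬ Removed (strand-vertex (toℕ t) σ a)
      kept t (inj₁ on-x) = proj₂ free 0F (t , on-x)
      kept t (inj₂ on-y) = proj₂ free 1F (t , on-y)
      along : Walk (spoke σ a) (strand-vertex d σ a)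
      along = strand d σ a kept
      arrives : iterate next a d ≡ b
      arrives = toℕ-injective (trans (toℕ-iterate-next-< d a a+d<n) (≡-sym b≡a+d))
      end-clean : ¬ Dirty (iterate next a d)
      end-clean = subst (λ j → ¬ Dirty j) (≡-sym arrives) b-clean

    hubs-joined : ∀ a b → ¬ Dirty a → ¬ Dirty b → Walk (hub a) (hub b)
    hubs-joined a b a-clean b-clean with ≤-total (toℕ a) (toℕ b)
    ... | inj₁ a≤b = hubs-joined-≤ a b (toℕ b ∸ toℕ a) (≡-sym (m+[n∸m]≡n a≤b)) a-clean b-clean
    ... | inj₂ b≤a = reverse (hubs-joined-≤ b a (toℕ a ∸ toℕ b) (≡-sym (m+[n∸m]≡n b≤a)) b-clean a-clean)

    to-hub : ∀ c {j} → ¬ Dirty j → ¬ Removed (vertex c j) → Walk (vertex c j) (hub j)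
    to-hub 0F          clean kept = here kept
    to-hub (suc s) {j} clean kept = edge kept (clean-kept clean 0F) (spoke-hub s j)

    -- From a spoke of a dirty block i, one of the blocks i ± 1 is clean.
    spoke-exit : ∀ s i → Dirty i → ¬ Removed (spoke s i) →
      ∃ λ j → ¬ Dirty j × Walk (spoke s i) (hub j)
    spoke-exit s i i-dirty kept with dirty? (next i)
    ... | no next-clean =
      next i , next-clean , edge kept k (spoke-next s i) ++ to-hub (suc (rot s)) next-clean k
      where
      k : ¬ Removed (spoke (rot s) (next i))
      k = clean-kept next-clean (suc (rot s))
    ... | yes next-dirty =
      prev i , prev-clean , edge kept k (spoke-prev s i) ++ to-hub (suc (rot⁻ s)) prev-clean k
      where
      prev-clean : ¬ Dirty (prev i)
      prev-clean = two-points i-dirty next-dirty (λ e → next-moves 2<n i (≡-sym e))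
                     (prev-moves 2<n i) (prev≢next 2<n i)
      k : ¬ Removed (spoke (rot⁻ s) (prev i))
      k = clean-kept prev-clean (suc (rot⁻ s))

    -- A hub of a dirty block first steps to a kept spoke of its block.
    reach-vertex : ∀ c i → ¬ Removed (vertex c i) → ∃ λ j → ¬ Dirty j × Walk (vertex c i) (hub j)
    reach-vertex c i kept with dirty? i
    ... | no clean = i , clean , to-hub c clean kept
    reach-vertex (suc s) i kept | yes dirty = spoke-exit s i dirty kept
    reach-vertex 0F      i kept | yes dirty with spoke-avoiding i x y
    ... | s , s≢x , s≢y with spoke-exit s i dirty [ s≢x , s≢y ]
    ... | j , clean , p = j , clean , edge kept [ s≢x , s≢y ] (hub-spoke s i) ++ p

    reach : ∀ u → ¬ Removed u → ∃ λ j → ¬ Dirty j × Walk u (hub j)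
    reach u kept = subst (λ z → ∃ λ j → ¬ Dirty j × Walk z (hub j)) (vertex-η u)
      (reach-vertex (colour u) (block u) (subst (λ z → ¬ Removed z) (≡-sym (vertex-η u)) kept))

    joined : ∀ u w → ¬ Removed u → ¬ Removed w → Walk u w
    joined u w u-kept w-kept with reach u u-kept | reach w w-kept
    ... | j , j-clean , p | k , k-clean , q = p ++ hubs-joined j k j-clean k-clean ++ reverse q

  three-connected : 2 < n → ThreeConnected graph
  three-connected 2<n = at-least-four , connected ,
    λ x y u w u≢x u≢y w≢x w≢y → Separation.joined 2<n x y u w [ u≢x , u≢y ] [ w≢x , w≢y ]
    where
    at-least-four : 3 < 4 * n
    at-least-four = *-monoʳ-≤ 4 (>-nonZero⁻¹ n)
    -- Connectivity: delete a single vertex different from both ends.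
    connected : Connected graph
    connected u w with spoke-avoiding (block u) u w
    ... | s , s≢u , s≢w = weaken graph (λ _ ())
      (Separation.joined 2<n z z u w [ u≢z , u≢z ] [ w≢z , w≢z ])
      where
      z : Fin (4 * n)
      z = spoke s (block u)
      u≢z : u ≢ z
      u≢z e = s≢u (≡-sym e)
      w≢z : w ≢ z
      w≢z e = s≢w (≡-sym e)

theorem4p2 : ∀ (n : ℕ) → 4 ≤ n → Σ (Graph (4 * n)) NontrivialCubicTotallySilver
theorem4p2 n 4≤n = graph , cubic , silver , three-connected (≤-trans (n≤1+n 3) 4≤n) , girth 4≤n
  where open Lift n {{>-nonZero (≤-trans (s≤s z≤n) 4≤n)}}
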